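{- Let $A$ be a finite-dimensional $\mathbb{Q}$-vector space with a right $\mathrm{PGL}(2,\mathbb{Z})$-action, and let $B=A^\vee$ be its dual with the right action defined by $\langle Q|_g,P\rangle=\langle Q,P|_{g^{ -1}}\rangle$ ($Q\in B$, $P\in A$, $g\in\mathrm{PGL}(2,\mathbb{Z})$). For $M\in\{A,B\}$ let $M^{\pm}=\{P\in M:P|_\epsilon=\pm P\}$, $\mathcal{W}(M)=\{P\in M:P|_{1+S}=0,\ P|_{(1+U+U^2)(1-S)}=0\}$ and $\mathcal{W}^+(M)=\mathcal{W}(M)\cap M^+$. Let $f_A:A^+\to A/A^-$ be $f_A(P)=P|_{1+U-U^2S}\bmod A^-$, and let $f_A^*:B^+\to B/B^-$ be its dual map, using the identifications $(A/A^-)^\vee=B^+$ and $(A^+)^\vee=B/B^-$ induced by the pairing. Then $\ker f_A^*=\mathcal{W}^+(B)$; the map $\iota:\mathcal{W}^+(A)\to\ker f_A$, $\iota(P)=P|_{U(1+\epsilon)}$, is well defined and bijective; and $\dim_{\mathbb{Q}}\mathcal{W}^+(A)=\dim_{\mathbb{Q}}\mathcal{W}^+(B)$.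
   Context: $\epsilon,S,U$ denote the images in $\mathrm{PGL}(2,\mathbb{Z})$ of $\begin{pmatrix}-1&0\\0&1\end{pmatrix}$, $\begin{pmatrix}0&-1\\1&0\end{pmatrix}$, $\begin{pmatrix}1&-1\\1&0\end{pmatrix}$; the actions are extended linearly to the group ring $\mathbb{Q}[\mathrm{PGL}(2,\mathbb{Z})]$. -}

module Defs where

open import Data.Nat using (ℕ; zero; suc)
open import Data.Fin using (Fin; zero; suc)
open import Data.Integer as ℤ using (ℤ; +_; -[1+_])
open import Data.Rational as ℚ using (ℚ; 0ℚ; 1ℚ)
open import Data.List using (List; []; _∷_; _++_; concatMap; map)
open import Data.Product using (Σ; _×_; _,_; ∃)
open import Data.Sum using (_⊎_)
open import Relation.Binary.PropositionalEquality using (_≡_)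

-- 2x2 integer matrices; PGL(2,ℤ) = {m : det m = ±1} modulo m ~ -m

record Mat2 : Set where
  constructor mat
  field a b c d : ℤ

open Mat2 public

det : Mat2 → ℤ
det m = (a m ℤ.* d m) ℤ.- (b m ℤ.* c m)

IsPGL : Mat2 → Set
IsPGL m = det m ≡ + 1 ⊎ det m ≡ -[1+ 0 ]

_⊙_ : Mat2 → Mat2 → Mat2
mat a₁ b₁ c₁ d₁ ⊙ mat a₂ b₂ c₂ d₂ =
  mat (a₁ ℤ.* a₂ ℤ.+ b₁ ℤ.* c₂) (a₁ ℤ.* b₂ ℤ.+ b₁ ℤ.* d₂)
      (c₁ ℤ.* a₂ ℤ.+ d₁ ℤ.* c₂) (c₁ ℤ.* b₂ ℤ.+ d₁ ℤ.* d₂)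

negM : Mat2 → Mat2
negM (mat a b c d) = mat (ℤ.- a) (ℤ.- b) (ℤ.- c) (ℤ.- d)

I₂ : Mat2
I₂ = mat (+ 1) (+ 0) (+ 0) (+ 1)

-- inverse in PGL(2,ℤ): the adjugate (= ± the inverse matrix, equal in PGL)
invM : Mat2 → Mat2
invM (mat a b c d) = mat d (ℤ.- b) (ℤ.- c) a

εM SM UM : Mat2
εM = mat -[1+ 0 ] (+ 0) (+ 0) (+ 1)
SM = mat (+ 0) -[1+ 0 ] (+ 1) (+ 0)
UM = mat (+ 1) -[1+ 0 ] (+ 1) (+ 0)

Vec : ℕ → Set
Vec n = Fin n → ℚ

Matrix : ℕ → Set
Matrix n = Fin n → Fin n → ℚ

Σ[_]_ : (n : ℕ) → (Fin n → ℚ) → ℚ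
Σ[ zero ] f = 0ℚ
Σ[ suc n ] f = f zero ℚ.+ Σ[ n ] (λ i → f (suc i))

_≋_ : ∀ {n} → Vec n → Vec n → Set
u ≋ v = ∀ i → u i ≡ v i

0v : ∀ {n} → Vec n
0v _ = 0ℚ

-ᵛ_ : ∀ {n} → Vec n → Vec n
(-ᵛ v) i = ℚ.- v i

δ : ∀ {n} → Fin n → Fin n → ℚ
δ zero zero = 1ℚ
δ zero (suc j) = 0ℚ
δ (suc i) zero = 0ℚ
δ (suc i) (suc j) = δ i j

-- standard pairing ⟨Q , P⟩ identifying B = A^∨ with ℚ^n
⟨_,_⟩ : ∀ {n} → Vec n → Vec n → ℚ
⟨_,_⟩ {n} Q P = Σ[ n ] (λ i → Q i ℚ.* P i)

lincomb : ∀ {n k} → (Fin k → ℚ) → (Fin k → Vec n) → Vec n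
lincomb {n} {k} c v j = Σ[ k ] (λ i → c i ℚ.* v i j)

actA : ∀ {n} → (Mat2 → Matrix n) → Mat2 → Vec n → Vec n
actA {n} ρ g P j = Σ[ n ] (λ i → P i ℚ.* ρ g i j)

record IsRightPGLAction {n : ℕ} (ρ : Mat2 → Matrix n) : Set where
  field
    act-id   : ∀ P → actA ρ I₂ P ≋ P
    act-comp : ∀ g h → IsPGL g → IsPGL h →
               ∀ P → actA ρ (g ⊙ h) P ≋ actA ρ h (actA ρ g P)
    act-neg  : ∀ g → IsPGL g → ∀ P → actA ρ (negM g) P ≋ actA ρ g P

-- the dual action on B = A^∨ ≅ ℚ^n:  ⟨Q|g , P⟩ = ⟨Q , P|g⁻¹⟩,
-- i.e. (Q|g)_j = Σ_i ρ(g⁻¹)_{ji} Q_i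
actB : ∀ {n} → (Mat2 → Matrix n) → Mat2 → Vec n → Vec n
actB {n} ρ g Q j = Σ[ n ] (λ i → ρ (invM g) j i ℚ.* Q i)

-- group ring ℚ[PGL(2,ℤ)]: formal finite sums Σ c_g g

GR : Set
GR = List (ℚ × Mat2)

_⊗_ : GR → GR → GR
xs ⊗ ys = concatMap (λ { (p , g) → map (λ { (q , h) → (p ℚ.* q , g ⊙ h) }) ys }) xs

actGR : ∀ {n} → (Mat2 → Vec n → Vec n) → GR → Vec n → Vec n
actGR act [] P = 0v
actGR act ((c , g) ∷ xs) P j = c ℚ.* act g P j ℚ.+ actGR act xs P j

-1ℚ : ℚ
-1ℚ = ℚ.- 1ℚ

e1+S : GR
e1+S = (1ℚ , I₂) ∷ (1ℚ , SM) ∷ []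

e1+U+U²·1-S : GR
e1+U+U²·1-S = ((1ℚ , I₂) ∷ (1ℚ , UM) ∷ (1ℚ , UM ⊙ UM) ∷ [])
              ⊗ ((1ℚ , I₂) ∷ (-1ℚ , SM) ∷ [])

e1+U-U²S : GR
e1+U-U²S = (1ℚ , I₂) ∷ (1ℚ , UM) ∷ (-1ℚ , (UM ⊙ UM) ⊙ SM) ∷ []

eU·1+ε : GR
eU·1+ε = ((1ℚ , UM) ∷ []) ⊗ ((1ℚ , I₂) ∷ (1ℚ , εM) ∷ [])

module _ {n : ℕ} (act : Mat2 → Vec n → Vec n) where

  Plus : Vec n → Set
  Plus P = act εM P ≋ P

  Minus : Vec n → Set
  Minus P = act εM P ≋ (-ᵛ P)

  W : Vec n → Set
  W P = (actGR act e1+S P ≋ 0v) × (actGR act e1+U+U²·1-S P ≋ 0v)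

  W⁺ : Vec n → Set
  W⁺ P = W P × Plus P

HasDim : ∀ {n} → (Vec n → Set) → ℕ → Set
HasDim {n} V k =
  Σ (Fin k → Vec n) λ b →
    (∀ i → V (b i)) ×
    (∀ c → lincomb c b ≋ 0v → ∀ i → c i ≡ 0ℚ) ×
    (∀ v → V v → ∃ λ c → lincomb c b ≋ v)

module _ {n : ℕ} (ρ : Mat2 → Matrix n) where

  KerFA : Vec n → Set
  KerFA P = Plus (actA ρ) P × Minus (actA ρ) (actGR (actA ρ) e1+U-U²S P)

  -- ker f_A^*, where f_A^* : B⁺ = (A/A⁻)^∨ → B/B⁻ = (A⁺)^∨ is the dual map,
  -- f_A^*(Q) = (P ∈ A⁺ ↦ ⟨Q , f_A(P)⟩)
  KerFA* : Vec n → Set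
  KerFA* Q = Plus (actB ρ) Q ×
             (∀ P → Plus (actA ρ) P → ⟨ Q , actGR (actA ρ) e1+U-U²S P ⟩ ≡ 0ℚ)

  ι : Vec n → Vec n
  ι P = actGR (actA ρ) eU·1+ε P

-- Every subspace in the proposition is the common annihilator of finitely many elements of
-- ℚ[PGL(2,ℤ)], and everything reduces to identities X = Y + Σᵢ rᵢ hᵢ in the group ring,
-- checked by normalisation. In any module, W⁺ is cut out by 1 − ε, 1 + S and
-- (1 + U + U²)(1 − S), and equally by 1 − ε and (1 + U − U²S)^⋆ π⁺, where π⁺ = (1 + ε)/2 and
-- ⋆ inverts group elements; the second element is adjoint to f_A, which gives
-- ker f_A^* = W⁺(B). Also ker f_A is cut out by 1 − ε and (1 + U − U²S)(1 + ε), and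
-- ι = U(1 + ε) and (S − 1)/2 are mutually inverse between W⁺(A) and ker f_A. Finally both
-- ker f_A and W⁺(B) are cut out by the single element μ = (1 + ε)(1 + U − U²S)(1 + ε) + (1 − ε),
-- resp. μ^⋆, so they are the left and right kernel of the matrix of μ on A, and a square matrix
-- has left and right kernels of equal dimension (Gaussian elimination).

module Submission where

open import Defs
open import Data.Nat as ℕ using (ℕ; zero; suc)
import Data.Nat.Properties as ℕ
open import Data.Fin using (Fin; zero; suc; punchIn; punchOut)
open import Data.Fin.Properties using (any?) renaming (_≟_ to _≟ᶠ_)
open import Data.Integer as ℤ using (ℤ)
import Data.Integer.Properties as ℤ
open import Data.Rational as ℚ using (ℚ; 0ℚ; 1ℚ; _+_; _*_; -_; _-_; _/_; 1/_; ≢-nonZero)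
open import Data.Rational.Properties
open import Data.Rational.Solver using (module +-*-Solver)
open import Data.Vec.Functional using (tail; insertAt; removeAt; transpose) renaming (_∷_ to _∷ᵛ_)
open import Data.Vec.Functional.Properties
  using (insertAt-lookup; removeAt-insertAt; insertAt-removeAt; removeAt-punchOut)
open import Algebra.Bundles using (module Ring)
open import Algebra.Properties.Semiring.Sum (Ring.semiring +-*-ring)
  using (sum; sum-remove; ∑-distrib-+; ∑-comm; *-distribˡ-sum; sum-replicate-zero)
open import Data.List as List using (List; []; _∷_; _++_; length)
open import Data.List.Relation.Unary.All as All using (All; []; _∷_)
open import Data.Bool using (Bool; true; false; T; _∧_)
open import Data.Bool.Properties using (T-∧)
open import Data.Product using (Σ; _×_; _,_; ∃; proj₂; map₁; map₂)
open import Data.Sum using (_⊎_; inj₁; inj₂)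
open import Data.Unit using (⊤; tt)
open import Function using (_∘_)
open import Function.Bundles using (_⇔_; mk⇔; Equivalence)
import Function.Properties.Equivalence as ⇔
open import Relation.Nullary using (Dec; yes; no; ¬?)
open import Relation.Nullary.Decidable
  using (isYes; True; toWitness; map′; _×-dec_; _⊎-dec_; decidable-stable)
open import Relation.Binary.PropositionalEquality
open import Data.Integer.Tactic.RingSolver using () renaming (solve-∀ to ℤ-solve-∀)
open +-*-Solver

Σ≗sum : ∀ n (f : Fin n → ℚ) → Σ[ n ] f ≡ sum f
Σ≗sum zero    f = refl
Σ≗sum (suc n) f = cong (f zero +_) (Σ≗sum n (f ∘ suc))

Σ-cong : ∀ n {f g : Fin n → ℚ} → (∀ i → f i ≡ g i) → Σ[ n ] f ≡ Σ[ n ] g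
Σ-cong zero    e = refl
Σ-cong (suc n) e = cong₂ _+_ (e zero) (Σ-cong n (e ∘ suc))

Σ-zero : ∀ n → Σ[ n ] (λ _ → 0ℚ) ≡ 0ℚ
Σ-zero n = trans (Σ≗sum n _) (sum-replicate-zero n)

Σ-distrib-+ : ∀ n (f g : Fin n → ℚ) → Σ[ n ] (λ i → f i + g i) ≡ Σ[ n ] f + Σ[ n ] g
Σ-distrib-+ n f g =
  trans (Σ≗sum n _) (trans (∑-distrib-+ f g) (sym (cong₂ _+_ (Σ≗sum n f) (Σ≗sum n g))))

Σ-*ˡ : ∀ n c (f : Fin n → ℚ) → Σ[ n ] (λ i → c * f i) ≡ c * Σ[ n ] f
Σ-*ˡ n c f = trans (Σ≗sum n _) (trans (sym (*-distribˡ-sum c f)) (cong (c *_) (sym (Σ≗sum n f))))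

Σ-*ʳ : ∀ n c (f : Fin n → ℚ) → Σ[ n ] (λ i → f i * c) ≡ Σ[ n ] f * c
Σ-*ʳ n c f = trans (Σ-cong n (λ i → *-comm (f i) c)) (trans (Σ-*ˡ n c f) (*-comm c _))

Σ-comm : ∀ n m (f : Fin n → Fin m → ℚ) →
         Σ[ n ] (λ i → Σ[ m ] (f i)) ≡ Σ[ m ] (λ j → Σ[ n ] (λ i → f i j))
Σ-comm n m f = begin
  Σ[ n ] (λ i → Σ[ m ] (f i))       ≡⟨ Σ-cong n (λ i → Σ≗sum m (f i)) ⟩
  Σ[ n ] (λ i → sum (f i))           ≡⟨ Σ≗sum n _ ⟩
  sum (λ i → sum (f i))              ≡⟨ ∑-comm f ⟩
  sum (λ j → sum (λ i → f i j))      ≡⟨ sym (Σ≗sum m _) ⟩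
  Σ[ m ] (λ j → sum (λ i → f i j))   ≡⟨ sym (Σ-cong m (λ j → Σ≗sum n _)) ⟩
  Σ[ m ] (λ j → Σ[ n ] (λ i → f i j)) ∎
  where open ≡-Reasoning

Σ-remove : ∀ m (j : Fin (suc m)) (f : Fin (suc m) → ℚ) → Σ[ suc m ] f ≡ f j + Σ[ m ] (removeAt f j)
Σ-remove m j f = trans (Σ≗sum (suc m) f) (trans (sum-remove {i = j} f) (cong (f j +_) (sym (Σ≗sum m _))))

Σ-δˡ : ∀ n (i : Fin n) (f : Fin n → ℚ) → Σ[ n ] (λ l → δ i l * f l) ≡ f i
Σ-δˡ (suc n) zero f =
  trans (cong₂ _+_ (*-identityˡ (f zero)) (trans (Σ-cong n (λ l → *-zeroˡ (f (suc l)))) (Σ-zero n)))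
        (+-identityʳ _)
Σ-δˡ (suc n) (suc i) f = trans (cong₂ _+_ (*-zeroˡ (f zero)) (Σ-δˡ n i (f ∘ suc))) (+-identityˡ _)

δ-sym : ∀ {n} (i j : Fin n) → δ i j ≡ δ j i
δ-sym zero    zero    = refl
δ-sym zero    (suc j) = refl
δ-sym (suc i) zero    = refl
δ-sym (suc i) (suc j) = δ-sym i j

Σ-δʳ : ∀ n (i : Fin n) (f : Fin n → ℚ) → Σ[ n ] (λ l → f l * δ l i) ≡ f i
Σ-δʳ n i f = trans (Σ-cong n (λ l → trans (*-comm (f l) _) (cong (_* f l) (δ-sym l i)))) (Σ-δˡ n i f)

infixl 6 _+ᵛ_
infixr 7 _·ᵛ_

_+ᵛ_ : ∀ {n} → Vec n → Vec n → Vec n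
(u +ᵛ v) i = u i + v i

_·ᵛ_ : ∀ {n} → ℚ → Vec n → Vec n
(c ·ᵛ v) i = c * v i

≋-sym : ∀ {n} {u v : Vec n} → u ≋ v → v ≋ u
≋-sym e i = sym (e i)

≋-trans : ∀ {n} {u v w : Vec n} → u ≋ v → v ≋ w → u ≋ w
≋-trans e f i = trans (e i) (f i)

≋-by-removeAt : ∀ {m} (i : Fin (suc m)) {u v : Vec (suc m)} →
                u i ≡ v i → removeAt u i ≋ removeAt v i → u ≋ v
≋-by-removeAt i {u} {v} e₁ e₂ j with i ≟ᶠ j
... | yes refl = e₁
... | no i≢j = trans (sym (removeAt-punchOut u i≢j)) (trans (e₂ (punchOut i≢j)) (removeAt-punchOut v i≢j))

record IsLinear {a b} (F : Vec a → Vec b) : Set where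
  field
    resp-≋ : ∀ {u v} → u ≋ v → F u ≋ F v
    +-hom  : ∀ u v → F (u +ᵛ v) ≋ (F u +ᵛ F v)
    ·-hom  : ∀ c v → F (c ·ᵛ v) ≋ (c ·ᵛ F v)

  0-hom : F 0v ≋ 0v
  0-hom j = trans (resp-≋ (λ _ → sym (*-zeroˡ 0ℚ)) j) (trans (·-hom 0ℚ 0v j) (*-zeroˡ (F 0v j)))

  lincomb-hom : ∀ {k} (c : Fin k → ℚ) (v : Fin k → Vec a) → F (lincomb c v) ≋ lincomb c (F ∘ v)
  lincomb-hom {zero}  c v = 0-hom
  lincomb-hom {suc k} c v j =
    trans (+-hom (c zero ·ᵛ v zero) (lincomb (c ∘ suc) (v ∘ suc)) j)
          (cong₂ _+_ (·-hom (c zero) (v zero) j) (lincomb-hom (c ∘ suc) (v ∘ suc) j))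

open IsLinear

id-linear : ∀ {a} → IsLinear {a} (λ v → v)
id-linear = record { resp-≋ = λ e → e ; +-hom = λ _ _ _ → refl ; ·-hom = λ _ _ _ → refl }

lincomb-resp-≋ : ∀ {a k} (c : Fin k → ℚ) {u v : Fin k → Vec a} →
                 (∀ i → u i ≋ v i) → lincomb c u ≋ lincomb c v
lincomb-resp-≋ {k = k} c e j = Σ-cong k (λ i → cong (c i *_) (e i j))

record LinearEquiv {a b} (V : Vec a → Set) (W : Vec b → Set) : Set where
  field
    to        : Vec a → Vec b
    from      : Vec b → Vec a
    to-linear   : IsLinear to
    from-linear : IsLinear from
    to-∈      : ∀ v → V v → W (to v)
    from-∈    : ∀ w → W w → V (from w)
    from∘to   : ∀ v → V v → from (to v) ≋ v
    to∘from   : ∀ w → W w → to (from w) ≋ w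

  to-injective : ∀ {v v′} → V v → V v′ → to v ≋ to v′ → v ≋ v′
  to-injective {v} {v′} v∈V v′∈V e =
    ≋-trans (≋-sym (from∘to v v∈V)) (≋-trans (resp-≋ from-linear e) (from∘to v′ v′∈V))

  to-surjective : ∀ w → W w → ∃ λ v → V v × (to v ≋ w)
  to-surjective w w∈W = from w , from-∈ w w∈W , to∘from w w∈W

LinearEquiv-resp-⇔ : ∀ {a b} {V V′ : Vec a → Set} {W W′ : Vec b → Set} →
                     (∀ v → V′ v ⇔ V v) → (∀ w → W′ w ⇔ W w) → LinearEquiv V W → LinearEquiv V′ W′
LinearEquiv-resp-⇔ V′⇔V W′⇔W e = record
  { to = to ; from = from ; to-linear = to-linear ; from-linear = from-linear
  ; to-∈ = λ v v∈ → Equivalence.from (W′⇔W _) (to-∈ v (Equivalence.to (V′⇔V v) v∈))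
  ; from-∈ = λ w w∈ → Equivalence.from (V′⇔V _) (from-∈ w (Equivalence.to (W′⇔W w) w∈))
  ; from∘to = λ v v∈ → from∘to v (Equivalence.to (V′⇔V v) v∈)
  ; to∘from = λ w w∈ → to∘from w (Equivalence.to (W′⇔W w) w∈) }
  where open LinearEquiv e

⇔-LinearEquiv : ∀ {a} {V W : Vec a → Set} → (∀ v → V v ⇔ W v) → LinearEquiv V W
⇔-LinearEquiv V⇔W = record
  { to = λ v → v ; from = λ v → v ; to-linear = id-linear ; from-linear = id-linear
  ; to-∈ = λ v → Equivalence.to (V⇔W v) ; from-∈ = λ v → Equivalence.from (V⇔W v)
  ; from∘to = λ _ _ _ → refl ; to∘from = λ _ _ _ → refl }

HasDim-transport : ∀ {a b k} {V : Vec a → Set} {W : Vec b → Set} →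
                   LinearEquiv V W → HasDim W k → HasDim V k
HasDim-transport {k = k} e (b , b∈W , independent , spanning) =
  from ∘ b , (λ i → from-∈ _ (b∈W i)) , independent′ , spanning′
  where
  open LinearEquiv e
  independent′ : ∀ c → lincomb c (from ∘ b) ≋ 0v → ∀ i → c i ≡ 0ℚ
  independent′ c eq = independent c (λ j → begin
    lincomb c b j              ≡⟨ lincomb-resp-≋ c (λ i → to∘from (b i) (b∈W i)) j ⟨
    lincomb c (to ∘ from ∘ b) j ≡⟨ lincomb-hom to-linear c (from ∘ b) j ⟨
    to (lincomb c (from ∘ b)) j ≡⟨ resp-≋ to-linear eq j ⟩
    to 0v j                    ≡⟨ 0-hom to-linear j ⟩
    0ℚ                         ∎)
    where open ≡-Reasoning
  spanning′ : ∀ v → _ → ∃ λ c → lincomb c (from ∘ b) ≋ v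
  spanning′ v v∈V with spanning (to v) (to-∈ v v∈V)
  ... | c , eq = c , λ j →
    trans (sym (lincomb-hom from-linear c b j)) (trans (resp-≋ from-linear eq j) (from∘to v v∈V j))

HasDim-resp-⇔ : ∀ {a k} {V W : Vec a → Set} → (∀ v → V v ⇔ W v) → HasDim W k → HasDim V k
HasDim-resp-⇔ V⇔W = HasDim-transport (⇔-LinearEquiv V⇔W)

HasDim-full : ∀ m → HasDim {m} (λ _ → ⊤) m
HasDim-full m =
  δ , (λ _ → tt) , (λ c e i → trans (sym (Σ-δʳ m i c)) (e i)) , (λ v _ → v , λ j → Σ-δʳ m j v)

HasDim-cons : ∀ {m k} {V : Vec m → Set} → V 0v → HasDim V k → HasDim (V ∘ tail) (suc k)
HasDim-cons {m} {k} {V} V0 (b , b∈V , independent , spanning) = b′ , b′∈V , independent′ , spanning′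
  where
  b′ : Fin (suc k) → Vec (suc m)
  b′ zero    = 1ℚ ∷ᵛ 0v
  b′ (suc i) = 0ℚ ∷ᵛ b i
  b′∈V : ∀ i → V (tail (b′ i))
  b′∈V zero    = V0
  b′∈V (suc i) = b∈V i
  lincomb-head : ∀ c → lincomb c b′ zero ≡ c zero
  lincomb-head c = trans (cong₂ _+_ (*-identityʳ (c zero))
                                    (trans (Σ-cong k (λ i → *-zeroʳ (c (suc i)))) (Σ-zero k)))
                         (+-identityʳ _)
  lincomb-tail : ∀ c j → lincomb c b′ (suc j) ≡ lincomb (c ∘ suc) b j
  lincomb-tail c j = trans (cong (_+ lincomb (c ∘ suc) b j) (*-zeroʳ (c zero))) (+-identityˡ _)
  independent′ : ∀ c → lincomb c b′ ≋ 0v → ∀ i → c i ≡ 0ℚ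
  independent′ c e zero    = trans (sym (lincomb-head c)) (e zero)
  independent′ c e (suc i) = independent (c ∘ suc) (λ j → trans (sym (lincomb-tail c j)) (e (suc j))) i
  spanning′ : ∀ v → V (tail v) → ∃ λ c → lincomb c b′ ≋ v
  spanning′ v v∈V with spanning (tail v) v∈V
  ... | c , e = v zero ∷ᵛ c , λ { zero → lincomb-head (v zero ∷ᵛ c)
                                 ; (suc j) → trans (lincomb-tail (v zero ∷ᵛ c) j) (e j) }

-- Kernels of matrices and Gaussian elimination

Mat : ℕ → ℕ → Set
Mat n m = Fin n → Fin m → ℚ

infixl 7 _*ᴹ_
infixr 7 _ᴹ*_

_*ᴹ_ : ∀ {n m} → Vec n → Mat n m → Vec m
_*ᴹ_ {n} v M j = Σ[ n ] (λ i → v i * M i j)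

_ᴹ*_ : ∀ {n m} → Mat n m → Vec m → Vec n
_ᴹ*_ {m = m} M w i = Σ[ m ] (λ j → M i j * w j)

LeftKernel : ∀ {n m} → Mat n m → Vec n → Set
LeftKernel M v = (v *ᴹ M) ≋ 0v

RightKernel : ∀ {n m} → Mat n m → Vec m → Set
RightKernel M w = (M ᴹ* w) ≋ 0v

*ᴹ-linear : ∀ {n m} (M : Mat n m) → IsLinear (_*ᴹ M)
*ᴹ-linear {n} M = record
  { resp-≋ = λ e j → Σ-cong n (λ i → cong (_* M i j) (e i))
  ; +-hom  = λ u v j → trans (Σ-cong n (λ i → *-distribʳ-+ (M i j) (u i) (v i))) (Σ-distrib-+ n _ _)
  ; ·-hom  = λ c v j → trans (Σ-cong n (λ i → *-assoc c (v i) (M i j))) (Σ-*ˡ n c _) }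

matrix : ∀ {n m} → (Vec n → Vec m) → Mat n m
matrix F i = F (δ i)

linear⇒*ᴹ-matrix : ∀ {n m} {F : Vec n → Vec m} → IsLinear F → ∀ P → F P ≋ (P *ᴹ matrix F)
linear⇒*ᴹ-matrix {n} {F = F} F-linear P =
  ≋-trans (resp-≋ F-linear (λ j → sym (Σ-δʳ n j P))) (lincomb-hom F-linear P δ)

ᴹ*-linear : ∀ {n m} (M : Mat n m) → IsLinear (M ᴹ*_)
ᴹ*-linear {m = m} M = record
  { resp-≋ = λ e i → Σ-cong m (λ j → cong (M i j *_) (e j))
  ; +-hom  = λ u v i → trans (Σ-cong m (λ j → *-distribˡ-+ (M i j) (u j) (v j))) (Σ-distrib-+ m _ _)
  ; ·-hom  = λ c v i →
      trans (Σ-cong m (λ j → solve 3 (λ a c v → a :* (c :* v) := c :* (a :* v)) refl (M i j) c (v j)))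
            (Σ-*ˡ m c _) }

LeftKernel-resp-≗ : ∀ {n m} {M N : Mat n m} → (∀ i j → M i j ≡ N i j) →
                    ∀ v → LeftKernel M v → LeftKernel N v
LeftKernel-resp-≗ {n} M≗N v h j = trans (Σ-cong n (λ i → cong (v i *_) (sym (M≗N i j)))) (h j)

ᴹ*≋*ᴹ-transpose : ∀ {n m} (M : Mat n m) (w : Vec m) → (M ᴹ* w) ≋ (w *ᴹ transpose M)
ᴹ*≋*ᴹ-transpose {m = m} M w i = Σ-cong m (λ j → *-comm (M i j) (w j))

RightKernel⇒LeftKernel-transpose : ∀ {n m} (M : Mat n m) w → RightKernel M w → LeftKernel (transpose M) w
RightKernel⇒LeftKernel-transpose M w h = ≋-trans (≋-sym (ᴹ*≋*ᴹ-transpose M w)) h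

LeftKernel-transpose⇒RightKernel : ∀ {n m} (M : Mat n m) w → LeftKernel (transpose M) w → RightKernel M w
LeftKernel-transpose⇒RightKernel M w h = ≋-trans (ᴹ*≋*ᴹ-transpose M w) h

*ᴹ-removeAt : ∀ {n m} (M : Mat (suc n) m) (i₀ : Fin (suc n)) (v : Vec (suc n)) j →
              (v *ᴹ M) j ≡ v i₀ * M i₀ j + (removeAt v i₀ *ᴹ removeAt M i₀) j
*ᴹ-removeAt {n} M i₀ v j = Σ-remove n i₀ (λ i → v i * M i j)

insertAt-linear : ∀ {a b} {F : Vec a → Vec b} → IsLinear F → (i : Fin (suc a)) (c : ℚ) (j : Fin b) →
                  IsLinear (λ v → insertAt v i (c * F v j))
insertAt-linear {F = F} F-linear i c j = record
  { resp-≋ = λ {u} {v} e → ≋-by-removeAt i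
      (trans (insertAt-lookup u i _) (trans (cong (c *_) (resp-≋ F-linear e j)) (sym (insertAt-lookup v i _))))
      (λ k → trans (removeAt-insertAt u i _ k) (trans (e k) (sym (removeAt-insertAt v i _ k))))
  ; +-hom = λ u v → ≋-by-removeAt i
      (trans (insertAt-lookup _ i _)
        (trans (cong (c *_) (+-hom F-linear u v j))
          (trans (*-distribˡ-+ c (F u j) (F v j))
            (sym (cong₂ _+_ (insertAt-lookup u i _) (insertAt-lookup v i _))))))
      (λ k → trans (removeAt-insertAt _ i _ k)
        (sym (cong₂ _+_ (removeAt-insertAt u i _ k) (removeAt-insertAt v i _ k))))
  ; ·-hom = λ d v → ≋-by-removeAt i
      (trans (insertAt-lookup _ i _)
        (trans (cong (c *_) (·-hom F-linear d v j))
          (trans (solve 3 (λ c d x → c :* (d :* x) := d :* (c :* x)) refl c d (F v j))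
            (sym (cong (d *_) (insertAt-lookup v i _))))))
      (λ k → trans (removeAt-insertAt _ i _ k) (sym (cong (d *_) (removeAt-insertAt v i _ k)))) }

Σ-*-subtract : ∀ n (w a b : Fin n → ℚ) k →
  Σ[ n ] (λ i → w i * (a i - b i * k)) ≡ Σ[ n ] (λ i → w i * a i) - Σ[ n ] (λ i → w i * b i) * k
Σ-*-subtract zero w a b k = solve 1 (λ k → con 0ℚ := con 0ℚ :- con 0ℚ :* k) refl k
Σ-*-subtract (suc n) w a b k =
  trans (cong (w zero * (a zero - b zero * k) +_) (Σ-*-subtract n (w ∘ suc) (a ∘ suc) (b ∘ suc) k))
        (solve 6 (λ w a b k s t → w :* (a :- b :* k) :+ (s :- t :* k) := (w :* a :+ s) :- (w :* b :+ t) :* k)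
               refl (w zero) (a zero) (b zero) k _ _)

schur-complement : ∀ {n m} → Mat (suc n) (suc m) → Fin (suc n) → Fin (suc m) → ℚ → Mat n m
schur-complement M i₀ j₀ q i j =
  M (punchIn i₀ i) (punchIn j₀ j) - M (punchIn i₀ i) j₀ * (M i₀ (punchIn j₀ j) * q)

module Elimination {n m} (M : Mat (suc n) (suc m)) (i₀ : Fin (suc n)) (j₀ : Fin (suc m))
                   (q : ℚ) (pivot : M i₀ j₀ * q ≡ 1ℚ) where

  private
    p = M i₀ j₀
    N = schur-complement M i₀ j₀ q
    M⁻ = removeAt M i₀

    cancel-pivot : ∀ v c a b → (v * c + a) - (v * p + b) * (c * q) ≡ a - b * (c * q)
    cancel-pivot v c a b = begin
      (v * c + a) - (v * p + b) * (c * q)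
        ≡⟨ solve 6 (λ v c a b p q → (v :* c :+ a) :- (v :* p :+ b) :* (c :* q)
                                   := (a :- b :* (c :* q)) :+ v :* c :* (con 1ℚ :- p :* q)) refl v c a b p q ⟩
      (a - b * (c * q)) + v * c * (1ℚ - p * q)
        ≡⟨ cong (λ t → (a - b * (c * q)) + v * c * (1ℚ - t)) pivot ⟩
      (a - b * (c * q)) + v * c * (1ℚ - 1ℚ)
        ≡⟨ solve 5 (λ v c a b q → (a :- b :* (c :* q)) :+ v :* c :* (con 1ℚ :- con 1ℚ)
                                 := a :- b :* (c :* q)) refl v c a b q ⟩
      a - b * (c * q) ∎
      where open ≡-Reasoning

    eliminate-pivot : ∀ s → (- q * s) * p + s ≡ 0ℚ
    eliminate-pivot s = begin
      (- q * s) * p + s       ≡⟨ solve 3 (λ q s p → (:- q :* s) :* p :+ s := s :* (con 1ℚ :- p :* q)) refl q s p ⟩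
      s * (1ℚ - p * q)        ≡⟨ cong (λ t → s * (1ℚ - t)) pivot ⟩
      s * (1ℚ - 1ℚ)           ≡⟨ solve 1 (λ s → s :* (con 1ℚ :- con 1ℚ) := con 0ℚ) refl s ⟩
      0ℚ                      ∎
      where open ≡-Reasoning

    solve-pivot : ∀ v s → v * p + s ≡ 0ℚ → - q * s ≡ v
    solve-pivot v s h = begin
      - q * s                 ≡⟨ cong (- q *_) (trans (solve 3 (λ v p s → s := (v :* p :+ s) :- v :* p) refl v p s)
                                                      (cong (_- v * p) h)) ⟩
      - q * (0ℚ - v * p)      ≡⟨ solve 3 (λ q v p → :- q :* (con 0ℚ :- v :* p) := v :* (p :* q)) refl q v p ⟩
      v * (p * q)             ≡⟨ trans (cong (v *_) pivot) (*-identityʳ v) ⟩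
      v                       ∎
      where open ≡-Reasoning

  removeAt-*ᴹ-schur-complement : ∀ v j →
    (removeAt v i₀ *ᴹ N) j ≡ (v *ᴹ M) (punchIn j₀ j) - (v *ᴹ M) j₀ * (M i₀ (punchIn j₀ j) * q)
  removeAt-*ᴹ-schur-complement v j = begin
    (removeAt v i₀ *ᴹ N) j
      ≡⟨ Σ-*-subtract n (removeAt v i₀) _ _ _ ⟩
    (v⁻ *ᴹ M⁻) (punchIn j₀ j) - (v⁻ *ᴹ M⁻) j₀ * (r * q)
      ≡⟨ cancel-pivot (v i₀) r _ _ ⟨
    (v i₀ * r + (v⁻ *ᴹ M⁻) (punchIn j₀ j)) - (v i₀ * p + (v⁻ *ᴹ M⁻) j₀) * (r * q)
      ≡⟨ cong₂ (λ a b → a - b * (r * q)) (*ᴹ-removeAt M i₀ v (punchIn j₀ j)) (*ᴹ-removeAt M i₀ v j₀) ⟨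
    (v *ᴹ M) (punchIn j₀ j) - (v *ᴹ M) j₀ * (r * q) ∎
    where
    open ≡-Reasoning
    v⁻ = removeAt v i₀
    r = M i₀ (punchIn j₀ j)

  extend : Vec n → Vec (suc n)
  extend w = insertAt w i₀ (- q * (w *ᴹ M⁻) j₀)

  *ᴹ-extend : ∀ w j → (extend w *ᴹ M) j ≡ (- q * (w *ᴹ M⁻) j₀) * M i₀ j + (w *ᴹ M⁻) j
  *ᴹ-extend w j = trans (*ᴹ-removeAt M i₀ (extend w) j)
    (cong₂ _+_ (cong (_* M i₀ j) (insertAt-lookup w i₀ _))
               (resp-≋ (*ᴹ-linear M⁻) (removeAt-insertAt w i₀ _) j))

  LeftKernel-schur-complement : LinearEquiv (LeftKernel M) (LeftKernel N)
  LeftKernel-schur-complement = record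
    { to = λ v → removeAt v i₀
    ; from = extend
    ; to-linear = record { resp-≋ = λ e k → e (punchIn i₀ k) ; +-hom = λ _ _ _ → refl ; ·-hom = λ _ _ _ → refl }
    ; from-linear = insertAt-linear (*ᴹ-linear M⁻) i₀ (- q) j₀
    ; to-∈ = λ v h j → trans (removeAt-*ᴹ-schur-complement v j)
        (trans (cong₂ (λ a b → a - b * (M i₀ (punchIn j₀ j) * q)) (h (punchIn j₀ j)) (h j₀))
               (solve 1 (λ x → con 0ℚ :- con 0ℚ :* x := con 0ℚ) refl (M i₀ (punchIn j₀ j) * q)))
    ; from-∈ = λ w h → ≋-by-removeAt j₀
        (trans (*ᴹ-extend w j₀) (eliminate-pivot _))
        (λ k → trans (*ᴹ-extend w (punchIn j₀ k))
          (trans (solve 4 (λ q s c a → (:- q :* s) :* c :+ a := a :- s :* (c :* q))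
                          refl q ((w *ᴹ M⁻) j₀) (M i₀ (punchIn j₀ k)) _)
                 (trans (sym (Σ-*-subtract n w _ _ _)) (h k))))
    ; from∘to = λ v h → ≋-trans
        (λ i → cong (λ x → insertAt (removeAt v i₀) i₀ x i)
                    (solve-pivot (v i₀) _ (trans (sym (*ᴹ-removeAt M i₀ v j₀)) (h j₀))))
        (insertAt-removeAt v i₀)
    ; to∘from = λ w _ → removeAt-insertAt w i₀ _ }

schur-complement-transpose : ∀ {n m} (M : Mat (suc n) (suc m)) i₀ j₀ q j i →
  schur-complement (transpose M) j₀ i₀ q j i ≡ transpose (schur-complement M i₀ j₀ q) j i
schur-complement-transpose M i₀ j₀ q j i = cong (λ t → M (punchIn i₀ i) (punchIn j₀ j) - t)
  (solve 3 (λ x y q → x :* (y :* q) := y :* (x :* q)) refl (M i₀ (punchIn j₀ j)) (M (punchIn i₀ i) j₀) q)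

RightKernel-schur-complement : ∀ {n m k} (M : Mat (suc n) (suc m)) i₀ j₀ q → M i₀ j₀ * q ≡ 1ℚ →
  HasDim (RightKernel (schur-complement M i₀ j₀ q)) k → HasDim (RightKernel M) k
RightKernel-schur-complement M i₀ j₀ q pivot =
  HasDim-resp-⇔ (λ w → mk⇔ (RightKernel⇒LeftKernel-transpose M w) (LeftKernel-transpose⇒RightKernel M w))
  ∘ HasDim-transport (Elimination.LeftKernel-schur-complement (transpose M) j₀ i₀ q pivot)
  ∘ HasDim-resp-⇔ (λ w → mk⇔
      (LeftKernel-transpose⇒RightKernel N w ∘ LeftKernel-resp-≗ (schur-complement-transpose M i₀ j₀ q) w)
      (LeftKernel-resp-≗ (λ j i → sym (schur-complement-transpose M i₀ j₀ q j i)) w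
       ∘ RightKernel⇒LeftKernel-transpose N w))
  where N = schur-complement M i₀ j₀ q

record Nullities {n m} (M : Mat n m) : Set where
  field
    left right : ℕ
    left-dim   : HasDim (LeftKernel M) left
    right-dim  : HasDim (RightKernel M) right
    balance    : left ℕ.+ m ≡ right ℕ.+ n

nullities-empty : ∀ {m} (M : Mat 0 m) → Nullities M
nullities-empty {m} M = record
  { left = 0 ; right = m
  ; left-dim = (λ ()) , (λ ()) , (λ _ _ ()) , (λ _ _ → (λ ()) , (λ ()))
  ; right-dim = HasDim-resp-⇔ (λ _ → mk⇔ (λ _ → tt) (λ _ ())) (HasDim-full m)
  ; balance = sym (ℕ.+-identityʳ m) }

nullities-zero-row : ∀ {n m} (M : Mat (suc n) m) → (∀ j → M zero j ≡ 0ℚ) →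
                     Nullities (tail M) → Nullities M
nullities-zero-row {n} {m} M row₀≡0 N = record
  { left = suc left ; right = right
  ; left-dim = HasDim-resp-⇔ (λ v → mk⇔ (λ h j → trans (sym (*ᴹ-zero-row v j)) (h j))
                                        (λ h j → trans (*ᴹ-zero-row v j) (h j)))
                             (HasDim-cons (λ j → trans (Σ-cong n (λ i → *-zeroˡ (M (suc i) j))) (Σ-zero n)) left-dim)
  ; right-dim = HasDim-resp-⇔ (λ w → mk⇔ (_∘ suc) (λ h → λ { zero → ᴹ*-zero-row w ; (suc i) → h i }))
                              right-dim
  ; balance = trans (cong suc balance) (sym (ℕ.+-suc right n)) }
  where
  open Nullities N
  *ᴹ-zero-row : ∀ v j → (v *ᴹ M) j ≡ (tail v *ᴹ tail M) j
  *ᴹ-zero-row v j = trans (cong (λ x → v zero * x + (tail v *ᴹ tail M) j) (row₀≡0 j))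
                          (trans (cong (_+ (tail v *ᴹ tail M) j) (*-zeroʳ (v zero))) (+-identityˡ _))
  ᴹ*-zero-row : ∀ w → (M ᴹ* w) zero ≡ 0ℚ
  ᴹ*-zero-row w = trans (Σ-cong m (λ j → trans (cong (_* w j) (row₀≡0 j)) (*-zeroˡ (w j)))) (Σ-zero m)

nullities-pivot : ∀ {n m} (M : Mat (suc n) (suc m)) j₀ q → M zero j₀ * q ≡ 1ℚ →
                  Nullities (schur-complement M zero j₀ q) → Nullities M
nullities-pivot {n} {m} M j₀ q pivot N = record
  { left = left ; right = right
  ; left-dim = HasDim-transport (Elimination.LeftKernel-schur-complement M zero j₀ q pivot) left-dim
  ; right-dim = RightKernel-schur-complement M zero j₀ q pivot right-dim
  ; balance = trans (ℕ.+-suc left m) (trans (cong suc balance) (sym (ℕ.+-suc right n))) }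
  where open Nullities N

nullities : ∀ n m (M : Mat n m) → Nullities M
nullities zero    m M = nullities-empty M
nullities (suc n) m M with any? (λ j → ¬? (M zero j ≟ 0ℚ))
nullities (suc n) (suc m) M | yes (j₀ , p≢0) =
  nullities-pivot M j₀ (1/ p) (*-inverseʳ p) (nullities n m (schur-complement M zero j₀ (1/ p)))
  where
  p = M zero j₀
  instance _ = ≢-nonZero p≢0
... | no ∄pivot = nullities-zero-row M (λ j → decidable-stable (M zero j ≟ 0ℚ) (λ ne → ∄pivot (j , ne)))
                                     (nullities n m (tail M))

square-nullities : ∀ n (M : Mat n n) → Σ ℕ λ k → HasDim (LeftKernel M) k × HasDim (RightKernel M) k
square-nullities n M = left , left-dim , subst (HasDim (RightKernel M)) (sym left≡right) right-dim
  where
  open Nullities (nullities n n M)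
  left≡right = ℕ.+-cancelʳ-≡ n left right balance

-- The group ring ℚ[PGL(2,ℤ)] acting on ℚⁿ

record IsLinearAction {n} (act : Mat2 → Vec n → Vec n) : Set where
  field
    linear      : ∀ g → IsLinear (act g)
    identity    : ∀ P → act I₂ P ≋ P
    composition : ∀ g h → IsPGL g → IsPGL h → ∀ P → act (g ⊙ h) P ≋ act h (act g P)
    negation    : ∀ g → IsPGL g → ∀ P → act (negM g) P ≋ act g P

InPGL : GR → Set
InPGL = All (IsPGL ∘ proj₂)

pgl? : ∀ g → Dec (IsPGL g)
pgl? g = det g ℤ.≟ ℤ.+ 1 ⊎-dec det g ℤ.≟ ℤ.-[1+ 0 ]

inPGL? : ∀ xs → Dec (InPGL xs)
inPGL? = All.all? (pgl? ∘ proj₂)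

_≟ᴹ_ : (g h : Mat2) → Dec (g ≡ h)
mat a b c d ≟ᴹ mat a′ b′ c′ d′ =
  map′ (λ { (refl , refl , refl , refl) → refl }) (λ { refl → refl , refl , refl , refl })
       (a ℤ.≟ a′ ×-dec b ℤ.≟ b′ ×-dec c ℤ.≟ c′ ×-dec d ℤ.≟ d′)

sameClass? : (g h : Mat2) → Dec (g ≡ h ⊎ g ≡ negM h)
sameClass? g h = g ≟ᴹ h ⊎-dec g ≟ᴹ negM h

classCoefficient : Mat2 → GR → ℚ
classCoefficient g [] = 0ℚ
classCoefficient g ((c , h) ∷ xs) with sameClass? g h
... | yes _ = c + classCoefficient g xs
... | no  _ = classCoefficient g xs

outsideClass : Mat2 → GR → GR
outsideClass g [] = []
outsideClass g ((c , h) ∷ xs) with sameClass? g h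
... | yes _ = outsideClass g xs
... | no  _ = (c , h) ∷ outsideClass g xs

-- Whether xs is zero in ℚ[PGL(2,ℤ)], where g and -g are identified. The ℕ is fuel: length xs
-- suffices, and running out of it answers false.
vanishes : ℕ → GR → Bool
vanishes _       []             = true
vanishes zero    (_ ∷ _)        = false
vanishes (suc k) ((c , g) ∷ xs) =
  isYes (c + classCoefficient g xs ≟ 0ℚ) ∧ vanishes k (outsideClass g xs)

negᴳ : GR → GR
negᴳ = List.map (map₁ (λ c → - c))

combination : List GR → List GR → GR
combination (r ∷ rs) (h ∷ hs) = r ⊗ h ++ combination rs hs
combination _        _        = []

FactorsInPGL : List GR → List GR → Set
FactorsInPGL (r ∷ rs) (h ∷ hs) = True (inPGL? r) × True (inPGL? h) × FactorsInPGL rs hs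
FactorsInPGL _        _        = ⊤

-- X = Y + Σᵢ rᵢ hᵢ in ℚ[PGL(2,ℤ)], for the multipliers hᵢ.
Reduces : List GR → GR → GR → List GR → Set
Reduces rs X Y hs = T (vanishes (length D) D) × True (inPGL? D) × FactorsInPGL rs hs
  where D = X ++ negᴳ (Y ++ combination rs hs)

record Reduction (rs : List GR) (X Y : GR) : Set where
  constructor reduction
  field
    multipliers : List GR
    valid       : Reduces rs X Y multipliers

1ᴳ 1-ε 1+ε : GR
1ᴳ  = (1ℚ , I₂) ∷ []
1-ε = (1ℚ , I₂) ∷ (-1ℚ , εM) ∷ []
1+ε = (1ℚ , I₂) ∷ (1ℚ , εM) ∷ []

module GroupRingAction {n} {act : Mat2 → Vec n → Vec n} (A : IsLinearAction act) where
  open IsLinearAction A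

  infixl 21 _∣_

  _∣_ : Vec n → GR → Vec n
  P ∣ X = actGR act X P

  Annihilated : List GR → Vec n → Set
  Annihilated rs P = All (λ r → P ∣ r ≋ 0v) rs

  ∣-linear : ∀ X → IsLinear (_∣ X)
  ∣-linear X = record { resp-≋ = λ e → respects X e ; +-hom = additive X ; ·-hom = homogeneous X }
    where
    respects : ∀ X {u v} → u ≋ v → u ∣ X ≋ v ∣ X
    respects []            e j = refl
    respects ((c , g) ∷ X) e j = cong₂ _+_ (cong (c *_) (resp-≋ (linear g) e j)) (respects X e j)
    additive : ∀ X u v → (u +ᵛ v) ∣ X ≋ (u ∣ X +ᵛ v ∣ X)
    additive []            u v j = sym (+-identityʳ 0ℚ)
    additive ((c , g) ∷ X) u v j =
      trans (cong₂ _+_ (cong (c *_) (+-hom (linear g) u v j)) (additive X u v j))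
            (solve 5 (λ c a b x y → c :* (a :+ b) :+ (x :+ y) := (c :* a :+ x) :+ (c :* b :+ y))
                   refl c (act g u j) (act g v j) _ _)
    homogeneous : ∀ X k v → (k ·ᵛ v) ∣ X ≋ (k ·ᵛ v ∣ X)
    homogeneous []            k v j = sym (*-zeroʳ k)
    homogeneous ((c , g) ∷ X) k v j =
      trans (cong₂ _+_ (cong (c *_) (·-hom (linear g) k v j)) (homogeneous X k v j))
            (solve 4 (λ c k a x → c :* (k :* a) :+ k :* x := k :* (c :* a :+ x)) refl c k (act g v j) _)

  ∣-++ : ∀ X Y P → P ∣ (X ++ Y) ≋ (P ∣ X +ᵛ P ∣ Y)
  ∣-++ []            Y P j = sym (+-identityˡ _)
  ∣-++ ((c , g) ∷ X) Y P j =
    trans (cong (c * act g P j +_) (∣-++ X Y P j)) (sym (+-assoc (c * act g P j) ((P ∣ X) j) ((P ∣ Y) j)))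

  ∣-negᴳ : ∀ X P → P ∣ negᴳ X ≋ (-ᵛ P ∣ X)
  ∣-negᴳ []            P j = refl
  ∣-negᴳ ((c , g) ∷ X) P j = trans (cong (- c * act g P j +_) (∣-negᴳ X P j))
    (solve 3 (λ c a x → (:- c) :* a :+ (:- x) := :- (c :* a :+ x)) refl c (act g P j) _)

  ∣-map-translate : ∀ p g {f : ℚ × Mat2 → ℚ × Mat2} → (∀ q h → f (q , h) ≡ (p * q , g ⊙ h)) →
                    IsPGL g → ∀ Y → InPGL Y → ∀ P → P ∣ List.map f Y ≋ (p ·ᵛ act g P ∣ Y)
  ∣-map-translate p g f≡ g∈ [] _ P j = sym (*-zeroʳ p)
  ∣-map-translate p g {f} f≡ g∈ ((q , h) ∷ Y) (h∈ ∷ Y∈) P j rewrite f≡ q h =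
    trans (cong₂ _+_ (cong (p * q *_) (composition g h g∈ h∈ P j)) (∣-map-translate p g f≡ g∈ Y Y∈ P j))
          (solve 4 (λ p q a x → p :* q :* a :+ p :* x := p :* (q :* a :+ x)) refl p q (act h (act g P) j) _)

  ∣-⊗ : ∀ X Y → InPGL X → InPGL Y → ∀ P → P ∣ (X ⊗ Y) ≋ P ∣ X ∣ Y
  ∣-⊗ []            Y _          Y∈ P = ≋-sym (0-hom (∣-linear Y))
  ∣-⊗ ((p , g) ∷ X) Y (g∈ ∷ X∈) Y∈ P = ≋-trans (∣-++ (List.map translate Y) (X ⊗ Y) P) (λ j → begin
    (P ∣ List.map translate Y) j + (P ∣ (X ⊗ Y)) j
      ≡⟨ cong₂ _+_ (∣-map-translate p g (λ _ _ → refl) g∈ Y Y∈ P j) (∣-⊗ X Y X∈ Y∈ P j) ⟩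
    p * (act g P ∣ Y) j + (P ∣ X ∣ Y) j
      ≡⟨ cong (_+ (P ∣ X ∣ Y) j) (·-hom (∣-linear Y) p (act g P) j) ⟨
    ((p ·ᵛ act g P) ∣ Y) j + (P ∣ X ∣ Y) j
      ≡⟨ +-hom (∣-linear Y) (p ·ᵛ act g P) (P ∣ X) j ⟨
    ((p ·ᵛ act g P +ᵛ P ∣ X) ∣ Y) j ∎)
    where
    open ≡-Reasoning
    translate : ℚ × Mat2 → ℚ × Mat2
    translate (q , h) = p * q , g ⊙ h

  ∣-classSplit : ∀ g X → InPGL X → ∀ P →
                 P ∣ X ≋ (classCoefficient g X ·ᵛ act g P +ᵛ P ∣ outsideClass g X)
  ∣-classSplit g [] _ P j = sym (trans (cong (_+ 0ℚ) (*-zeroˡ (act g P j))) (+-identityˡ 0ℚ))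
  ∣-classSplit g ((c , h) ∷ X) (h∈ ∷ X∈) P j with sameClass? g h
  ... | yes g~h = trans (cong₂ _+_ (cong (c *_) (same-action g~h)) (∣-classSplit g X X∈ P j))
    (solve 4 (λ c a s x → c :* a :+ (s :* a :+ x) := (c :+ s) :* a :+ x)
           refl c (act g P j) (classCoefficient g X) ((P ∣ outsideClass g X) j))
    where
    same-action : g ≡ h ⊎ g ≡ negM h → act h P j ≡ act g P j
    same-action (inj₁ refl) = refl
    same-action (inj₂ refl) = sym (negation h h∈ P j)
  ... | no _ = trans (cong (c * act h P j +_) (∣-classSplit g X X∈ P j))
    (solve 3 (λ y s x → y :+ (s :+ x) := s :+ (y :+ x)) refl
           (c * act h P j) (classCoefficient g X * act g P j) ((P ∣ outsideClass g X) j))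

  outsideClass-InPGL : ∀ g X → InPGL X → InPGL (outsideClass g X)
  outsideClass-InPGL g [] _ = []
  outsideClass-InPGL g ((c , h) ∷ X) (h∈ ∷ X∈) with sameClass? g h
  ... | yes _ = outsideClass-InPGL g X X∈
  ... | no  _ = h∈ ∷ outsideClass-InPGL g X X∈

  vanishes-sound : ∀ k X → T (vanishes k X) → InPGL X → ∀ P → P ∣ X ≋ 0v
  vanishes-sound _       []             _  _          P _ = refl
  vanishes-sound (suc k) ((c , g) ∷ X) ok (g∈ ∷ X∈) P j with Equivalence.to T-∧ ok
  ... | coefficient≡0 , rest-vanishes = begin
    c * act g P j + (P ∣ X) j
      ≡⟨ cong (c * act g P j +_) (∣-classSplit g X X∈ P j) ⟩
    c * act g P j + (classCoefficient g X * act g P j + (P ∣ outsideClass g X) j)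
      ≡⟨ solve 4 (λ c s a x → c :* a :+ (s :* a :+ x) := (c :+ s) :* a :+ x)
               refl c (classCoefficient g X) (act g P j) ((P ∣ outsideClass g X) j) ⟩
    (c + classCoefficient g X) * act g P j + (P ∣ outsideClass g X) j
      ≡⟨ cong₂ (λ s x → s * act g P j + x) (toWitness {a? = c + classCoefficient g X ≟ 0ℚ} coefficient≡0)
               (vanishes-sound k _ rest-vanishes (outsideClass-InPGL g X X∈) P j) ⟩
    0ℚ * act g P j + 0ℚ
      ≡⟨ trans (+-identityʳ _) (*-zeroˡ (act g P j)) ⟩
    0ℚ ∎
    where open ≡-Reasoning

  ∣-combination : ∀ rs hs → FactorsInPGL rs hs → ∀ {P} → Annihilated rs P → P ∣ combination rs hs ≋ 0v
  ∣-combination []       _        _  _ _ = refl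
  ∣-combination (_ ∷ _)  []       _  _ _ = refl
  ∣-combination (r ∷ rs) (h ∷ hs) (r∈ , h∈ , factors) {P} (P∣r≡0 ∷ ann) j = begin
    (P ∣ (r ⊗ h ++ combination rs hs)) j
      ≡⟨ ∣-++ (r ⊗ h) (combination rs hs) P j ⟩
    (P ∣ (r ⊗ h)) j + (P ∣ combination rs hs) j
      ≡⟨ cong₂ _+_ (∣-⊗ r h (toWitness {a? = inPGL? r} r∈) (toWitness {a? = inPGL? h} h∈) P j)
                   (∣-combination rs hs factors ann j) ⟩
    (P ∣ r ∣ h) j + 0ℚ
      ≡⟨ cong (_+ 0ℚ) (trans (resp-≋ (∣-linear h) P∣r≡0 j) (0-hom (∣-linear h) j)) ⟩
    0ℚ + 0ℚ ∎
    where open ≡-Reasoning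

  reduction-sound : ∀ {rs X Y} → Reduction rs X Y → ∀ {P} → Annihilated rs P → P ∣ X ≋ P ∣ Y
  reduction-sound {rs} {X} {Y} (reduction hs (D-vanishes , D∈ , factors)) {P} ann j = begin
    x                                  ≡⟨ solve 3 (λ x y z → x := (x :+ :- (y :+ z)) :+ y :+ z) refl x y z ⟩
    (x + - (y + z)) + y + z
      ≡⟨ cong₂ (λ d z → d + y + z) difference≡0 (∣-combination rs hs factors ann j) ⟩
    0ℚ + y + 0ℚ                         ≡⟨ trans (+-identityʳ _) (+-identityˡ y) ⟩
    y                                  ∎
    where
    open ≡-Reasoning
    x = (P ∣ X) j
    y = (P ∣ Y) j
    z = (P ∣ combination rs hs) j
    D = X ++ negᴳ (Y ++ combination rs hs)
    difference≡0 : x + - (y + z) ≡ 0ℚ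
    difference≡0 = begin
      x + - (y + z)   ≡⟨ cong (x +_) (cong -_ (∣-++ Y (combination rs hs) P j)) ⟨
      x + - (P ∣ (Y ++ combination rs hs)) j    ≡⟨ cong (x +_) (∣-negᴳ (Y ++ combination rs hs) P j) ⟨
      x + (P ∣ negᴳ (Y ++ combination rs hs)) j ≡⟨ ∣-++ X (negᴳ (Y ++ combination rs hs)) P j ⟨
      (P ∣ D) j       ≡⟨ vanishes-sound (length D) D D-vanishes (toWitness {a? = inPGL? D} D∈) P j ⟩
      0ℚ ∎

  ⊗-split : ∀ X Y {_ : True (inPGL? X)} {_ : True (inPGL? Y)} P → P ∣ (X ⊗ Y) ≋ P ∣ X ∣ Y
  ⊗-split X Y {X∈} {Y∈} = ∣-⊗ X Y (toWitness X∈) (toWitness Y∈)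

  ⊗-reduction : ∀ {rs} X Y {Z} {_ : True (inPGL? X)} {_ : True (inPGL? Y)} →
                Reduction rs (X ⊗ Y) Z → ∀ {P} → Annihilated rs P → P ∣ X ∣ Y ≋ P ∣ Z
  ⊗-reduction X Y {_} {X∈} {Y∈} red {P} ann =
    ≋-trans (≋-sym (⊗-split X Y {X∈} {Y∈} P)) (reduction-sound red ann)

  ∣-1ᴳ : ∀ P → P ∣ 1ᴳ ≋ P
  ∣-1ᴳ P j = trans (+-identityʳ _) (trans (*-identityˡ _) (identity P j))

  Plus⇔1-ε : ∀ P → Plus act P ⇔ (P ∣ 1-ε ≋ 0v)
  Plus⇔1-ε P = mk⇔
    (λ h j → trans (cong₂ (λ a e → 1ℚ * a + (-1ℚ * e + 0ℚ)) (identity P j) (h j))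
                   (solve 1 (λ p → con 1ℚ :* p :+ (con -1ℚ :* p :+ con 0ℚ) := con 0ℚ) refl (P j)))
    (λ h j → begin
      act εM P j                ≡⟨ solve 2 (λ a e → e := a :- (con 1ℚ :* a :+ (con -1ℚ :* e :+ con 0ℚ)))
                                         refl (act I₂ P j) (act εM P j) ⟩
      act I₂ P j - (P ∣ 1-ε) j  ≡⟨ cong₂ _-_ (identity P j) (h j) ⟩
      P j - 0ℚ                  ≡⟨ solve 1 (λ p → p :- con 0ℚ := p) refl (P j) ⟩
      P j                       ∎)
    where open ≡-Reasoning

  Minus⇔1+ε : ∀ P → Minus act P ⇔ (P ∣ 1+ε ≋ 0v)
  Minus⇔1+ε P = mk⇔
    (λ h j → trans (cong₂ (λ a e → 1ℚ * a + (1ℚ * e + 0ℚ)) (identity P j) (h j))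
                   (solve 1 (λ p → con 1ℚ :* p :+ (con 1ℚ :* (:- p) :+ con 0ℚ) := con 0ℚ) refl (P j)))
    (λ h j → begin
      act εM P j                   ≡⟨ solve 2 (λ a e → e := (:- a) :+ (con 1ℚ :* a :+ (con 1ℚ :* e :+ con 0ℚ)))
                                            refl (act I₂ P j) (act εM P j) ⟩
      - act I₂ P j + (P ∣ 1+ε) j   ≡⟨ cong₂ (λ a b → - a + b) (identity P j) (h j) ⟩
      - P j + 0ℚ                   ≡⟨ +-identityʳ _ ⟩
      - P j                        ∎)
    where open ≡-Reasoning

⟨⟩-respˡ : ∀ {n} {u v : Vec n} P → u ≋ v → ⟨ u , P ⟩ ≡ ⟨ v , P ⟩
⟨⟩-respˡ {n} P e = Σ-cong n (λ i → cong (_* P i) (e i))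

⟨⟩-respʳ : ∀ {n} (Q : Vec n) {u v} → u ≋ v → ⟨ Q , u ⟩ ≡ ⟨ Q , v ⟩
⟨⟩-respʳ {n} Q e = Σ-cong n (λ i → cong (Q i *_) (e i))

⟨0v,⟩ : ∀ {n} (P : Vec n) → ⟨ 0v , P ⟩ ≡ 0ℚ
⟨0v,⟩ {n} P = trans (Σ-cong n (λ i → *-zeroˡ (P i))) (Σ-zero n)

⟨,0v⟩ : ∀ {n} (Q : Vec n) → ⟨ Q , 0v ⟩ ≡ 0ℚ
⟨,0v⟩ {n} Q = trans (Σ-cong n (λ i → *-zeroʳ (Q i))) (Σ-zero n)

⟨⟩-linearˡ : ∀ {n} c (u v P : Vec n) → ⟨ c ·ᵛ u +ᵛ v , P ⟩ ≡ c * ⟨ u , P ⟩ + ⟨ v , P ⟩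
⟨⟩-linearˡ {n} c u v P =
  trans (Σ-cong n (λ i → solve 4 (λ c u v p → (c :* u :+ v) :* p := c :* (u :* p) :+ v :* p)
                                 refl c (u i) (v i) (P i)))
        (trans (Σ-distrib-+ n _ _) (cong (_+ ⟨ v , P ⟩) (Σ-*ˡ n c _)))

⟨⟩-linearʳ : ∀ {n} c (Q u v : Vec n) → ⟨ Q , c ·ᵛ u +ᵛ v ⟩ ≡ c * ⟨ Q , u ⟩ + ⟨ Q , v ⟩
⟨⟩-linearʳ {n} c Q u v =
  trans (Σ-cong n (λ i → solve 4 (λ c q u v → q :* (c :* u :+ v) := c :* (q :* u) :+ q :* v)
                                 refl c (Q i) (u i) (v i)))
        (trans (Σ-distrib-+ n _ _) (cong (_+ ⟨ Q , v ⟩) (Σ-*ˡ n c _)))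

⟨,δ⟩ : ∀ {n} (v : Vec n) j → ⟨ v , δ j ⟩ ≡ v j
⟨,δ⟩ {n} v j = trans (Σ-cong n (λ l → cong (v l *_) (δ-sym j l))) (Σ-δʳ n j v)

≋-by-pairing : ∀ {n} {u v : Vec n} → (∀ P → ⟨ u , P ⟩ ≡ ⟨ v , P ⟩) → u ≋ v
≋-by-pairing {u = u} {v} h j = trans (sym (⟨,δ⟩ u j)) (trans (h (δ j)) (⟨,δ⟩ v j))

⟨ᴹ*,⟩ : ∀ {n} (M : Mat n n) Q P → ⟨ M ᴹ* Q , P ⟩ ≡ ⟨ Q , P *ᴹ M ⟩
⟨ᴹ*,⟩ {n} M Q P = begin
  Σ[ n ] (λ j → Σ[ n ] (λ i → M j i * Q i) * P j)   ≡⟨ Σ-cong n (λ j → sym (Σ-*ʳ n (P j) _)) ⟩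
  Σ[ n ] (λ j → Σ[ n ] (λ i → M j i * Q i * P j))   ≡⟨ Σ-comm n n _ ⟩
  Σ[ n ] (λ i → Σ[ n ] (λ j → M j i * Q i * P j))
    ≡⟨ Σ-cong n (λ i → trans
         (Σ-cong n (λ j → solve 3 (λ a q p → a :* q :* p := q :* (p :* a)) refl (M j i) (Q i) (P j)))
         (Σ-*ˡ n (Q i) _)) ⟩
  Σ[ n ] (λ i → Q i * Σ[ n ] (λ j → P j * M j i))   ∎
  where open ≡-Reasoning

-- The dual action

mat-cong : ∀ {a₁ b₁ c₁ d₁ a₂ b₂ c₂ d₂} → a₁ ≡ a₂ → b₁ ≡ b₂ → c₁ ≡ c₂ → d₁ ≡ d₂ →
           mat a₁ b₁ c₁ d₁ ≡ mat a₂ b₂ c₂ d₂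
mat-cong refl refl refl refl = refl

invM-⊙ : ∀ g h → invM (g ⊙ h) ≡ invM h ⊙ invM g
invM-⊙ (mat a₁ b₁ c₁ d₁) (mat a₂ b₂ c₂ d₂) =
  mat-cong (e₁ c₁ b₂ d₁ d₂) (e₂ a₁ b₂ b₁ d₂) (e₃ c₁ a₂ d₁ c₂) (e₄ a₁ a₂ b₁ c₂)
  where
  e₁ : ∀ c₁ b₂ d₁ d₂ → c₁ ℤ.* b₂ ℤ.+ d₁ ℤ.* d₂ ≡ d₂ ℤ.* d₁ ℤ.+ ℤ.- b₂ ℤ.* ℤ.- c₁
  e₁ = ℤ-solve-∀
  e₂ : ∀ a₁ b₂ b₁ d₂ → ℤ.- (a₁ ℤ.* b₂ ℤ.+ b₁ ℤ.* d₂) ≡ d₂ ℤ.* ℤ.- b₁ ℤ.+ ℤ.- b₂ ℤ.* a₁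
  e₂ = ℤ-solve-∀
  e₃ : ∀ c₁ a₂ d₁ c₂ → ℤ.- (c₁ ℤ.* a₂ ℤ.+ d₁ ℤ.* c₂) ≡ ℤ.- c₂ ℤ.* d₁ ℤ.+ a₂ ℤ.* ℤ.- c₁
  e₃ = ℤ-solve-∀
  e₄ : ∀ a₁ a₂ b₁ c₂ → a₁ ℤ.* a₂ ℤ.+ b₁ ℤ.* c₂ ≡ ℤ.- c₂ ℤ.* ℤ.- b₁ ℤ.+ a₂ ℤ.* a₁
  e₄ = ℤ-solve-∀

det-invM : ∀ g → det (invM g) ≡ det g
det-invM (mat a b c d) = e a b c d
  where
  e : ∀ a b c d → d ℤ.* a ℤ.- ℤ.- b ℤ.* ℤ.- c ≡ a ℤ.* d ℤ.- b ℤ.* c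
  e = ℤ-solve-∀

invM-IsPGL : ∀ g → IsPGL g → IsPGL (invM g)
invM-IsPGL g (inj₁ e) = inj₁ (trans (det-invM g) e)
invM-IsPGL g (inj₂ e) = inj₂ (trans (det-invM g) e)

invM-involutive : ∀ g → invM (invM g) ≡ g
invM-involutive (mat a b c d) = mat-cong refl (ℤ.neg-involutive b) (ℤ.neg-involutive c) refl

infixl 30 _⋆

_⋆ : GR → GR
_⋆ = List.map (map₂ invM)

⋆-involutive : ∀ X → X ⋆ ⋆ ≡ X
⋆-involutive []            = refl
⋆-involutive ((c , g) ∷ X) = cong₂ (λ h Y → (c , h) ∷ Y) (invM-involutive g) (⋆-involutive X)

module Actions {n} (ρ : Mat2 → Matrix n) (R : IsRightPGLAction ρ) where
  open IsRightPGLAction R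

  actA-isLinearAction : IsLinearAction (actA ρ)
  actA-isLinearAction = record
    { linear = λ g → *ᴹ-linear (ρ g) ; identity = act-id ; composition = act-comp ; negation = act-neg }

  actB-adjoint : ∀ g Q P → ⟨ actB ρ g Q , P ⟩ ≡ ⟨ Q , actA ρ (invM g) P ⟩
  actB-adjoint g = ⟨ᴹ*,⟩ (ρ (invM g))

  actB-isLinearAction : IsLinearAction (actB ρ)
  actB-isLinearAction = record
    { linear = λ g → ᴹ*-linear (ρ (invM g))
    ; identity = λ Q → ≋-by-pairing λ P → trans (actB-adjoint I₂ Q P) (⟨⟩-respʳ Q (act-id P))
    ; composition = λ g h g∈ h∈ Q → ≋-by-pairing λ P → begin
        ⟨ actB ρ (g ⊙ h) Q , P ⟩                    ≡⟨ actB-adjoint (g ⊙ h) Q P ⟩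
        ⟨ Q , actA ρ (invM (g ⊙ h)) P ⟩              ≡⟨ cong (λ k → ⟨ Q , actA ρ k P ⟩) (invM-⊙ g h) ⟩
        ⟨ Q , actA ρ (invM h ⊙ invM g) P ⟩
          ≡⟨ ⟨⟩-respʳ Q (act-comp _ _ (invM-IsPGL h h∈) (invM-IsPGL g g∈) P) ⟩
        ⟨ Q , actA ρ (invM g) (actA ρ (invM h) P) ⟩  ≡⟨ actB-adjoint g Q _ ⟨
        ⟨ actB ρ g Q , actA ρ (invM h) P ⟩           ≡⟨ actB-adjoint h _ P ⟨
        ⟨ actB ρ h (actB ρ g Q) , P ⟩                ∎
    ; negation = λ g g∈ Q → ≋-by-pairing λ P →
        trans (actB-adjoint (negM g) Q P)
              (trans (⟨⟩-respʳ Q (act-neg (invM g) (invM-IsPGL g g∈) P)) (sym (actB-adjoint g Q P))) }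
    where open ≡-Reasoning

  open GroupRingAction actA-isLinearAction public using () renaming (_∣_ to _∣ᴬ_)
  open GroupRingAction actB-isLinearAction public using () renaming (_∣_ to _∣ᴮ_)

  ∣ᴮ-adjoint : ∀ X Q P → ⟨ Q ∣ᴮ X , P ⟩ ≡ ⟨ Q , P ∣ᴬ X ⋆ ⟩
  ∣ᴮ-adjoint []            Q P = trans (⟨0v,⟩ P) (sym (⟨,0v⟩ Q))
  ∣ᴮ-adjoint ((c , g) ∷ X) Q P =
    trans (⟨⟩-linearˡ c (actB ρ g Q) (Q ∣ᴮ X) P)
          (trans (cong₂ (λ a b → c * a + b) (actB-adjoint g Q P) (∣ᴮ-adjoint X Q P))
                 (sym (⟨⟩-linearʳ c Q _ _)))

  ∣ᴮ⋆≋matrix : ∀ X Q → Q ∣ᴮ X ⋆ ≋ (matrix (_∣ᴬ X) ᴹ* Q)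
  ∣ᴮ⋆≋matrix X Q i = begin
    (Q ∣ᴮ X ⋆) i                           ≡⟨ ⟨,δ⟩ (Q ∣ᴮ X ⋆) i ⟨
    ⟨ Q ∣ᴮ X ⋆ , δ i ⟩                     ≡⟨ ∣ᴮ-adjoint (X ⋆) Q (δ i) ⟩
    ⟨ Q , δ i ∣ᴬ X ⋆ ⋆ ⟩                   ≡⟨ cong (λ Y → ⟨ Q , δ i ∣ᴬ Y ⟩) (⋆-involutive X) ⟩
    ⟨ Q , δ i ∣ᴬ X ⟩                       ≡⟨ Σ-cong n (λ j → *-comm (Q j) _) ⟩
    (matrix (_∣ᴬ X) ᴹ* Q) i                ∎
    where open ≡-Reasoning

-- Identities in ℚ[PGL(2,ℤ)]

½ ¼ : ℚ
½ = ℤ.+ 1 / 2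
¼ = ℤ.+ 1 / 4

π⁺ ι⁻¹ μ : GR
π⁺  = (½ , I₂) ∷ (½ , εM) ∷ []
ι⁻¹ = (- ½ , I₂) ∷ (½ , SM) ∷ []
μ   = ((1+ε ⊗ e1+U-U²S) ⊗ 1+ε) ++ 1-ε

W⁺-relations kerfA-relations W⁺-relations′ : List GR
W⁺-relations    = 1-ε ∷ e1+S ∷ e1+U+U²·1-S ∷ []
kerfA-relations = 1-ε ∷ e1+U-U²S ⊗ 1+ε ∷ []
W⁺-relations′   = 1-ε ∷ e1+U-U²S ⋆ ⊗ π⁺ ∷ []

π⁺-plus : Reduction [] (π⁺ ⊗ 1-ε) []
π⁺-plus = reduction [] _

e1+U-U²S⋆⊗π⁺-adjoint : Reduction [] ((e1+U-U²S ⋆ ⊗ π⁺) ⋆) (π⁺ ⊗ e1+U-U²S)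
e1+U-U²S⋆⊗π⁺-adjoint = reduction [] _

e1+U-U²S-plus-part : Reduction (1-ε ∷ []) e1+U-U²S (π⁺ ⊗ e1+U-U²S)
e1+U-U²S-plus-part = reduction (((½ , I₂) ∷ (½ , UM) ∷ (½ , (SM ⊙ UM) ⊙ εM) ∷ []) ∷ []) _

ι-plus : Reduction [] (eU·1+ε ⊗ 1-ε) []
ι-plus = reduction [] _

ι-kerfA : Reduction W⁺-relations (eU·1+ε ⊗ (e1+U-U²S ⊗ 1+ε)) []
ι-kerfA = reduction
  ( ((1ℚ , I₂) ∷ (1ℚ , SM) ∷ (-1ℚ , ((SM ⊙ UM) ⊙ εM) ⊙ UM) ∷ (-1ℚ , (((SM ⊙ UM) ⊙ εM) ⊙ UM) ⊙ εM) ∷ [])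
  ∷ ((- (1ℚ + 1ℚ) , I₂) ∷ (1ℚ , UM) ∷ (1ℚ , UM ⊙ εM) ∷ (1ℚ , (UM ⊙ εM) ⊙ UM) ∷ (1ℚ , ((UM ⊙ εM) ⊙ UM) ⊙ εM) ∷ [])
  ∷ ((1ℚ , UM) ∷ (1ℚ , UM ⊙ εM) ∷ [])
  ∷ []) _

ι⊗ι⁻¹≡1 : Reduction W⁺-relations (eU·1+ε ⊗ ι⁻¹) 1ᴳ
ι⊗ι⁻¹≡1 = reduction
  ( ((- ½ , (SM ⊙ UM) ⊙ UM) ∷ (½ , (SM ⊙ UM) ⊙ εM) ∷ [])
  ∷ ((- ½ , I₂) ∷ (½ , UM ⊙ UM) ∷ (- ½ , UM ⊙ εM) ∷ [])
  ∷ ((- ½ , I₂) ∷ [])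
  ∷ []) _

ι⁻¹-plus : Reduction kerfA-relations (ι⁻¹ ⊗ 1-ε) []
ι⁻¹-plus = reduction (((- ½ , I₂) ∷ (½ , SM) ∷ []) ∷ []) _

ι⁻¹-1+S : Reduction kerfA-relations (ι⁻¹ ⊗ e1+S) []
ι⁻¹-1+S = reduction [] _

ι⁻¹-1+U+U²·1-S : Reduction kerfA-relations (ι⁻¹ ⊗ e1+U+U²·1-S) []
ι⁻¹-1+U+U²·1-S = reduction
  ( ((- ½ , I₂) ∷ (½ , SM) ∷ (½ , SM ⊙ UM) ∷ (½ , UM ⊙ εM) ∷ (- ½ , (SM ⊙ UM) ⊙ SM) ∷ (½ , (SM ⊙ UM) ⊙ UM) ∷ [])
  ∷ ((- ½ , I₂) ∷ (½ , SM) ∷ [])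
  ∷ []) _

ι⁻¹⊗ι≡1 : Reduction kerfA-relations (ι⁻¹ ⊗ eU·1+ε) 1ᴳ
ι⁻¹⊗ι≡1 = reduction
  ( ((- ½ , I₂) ∷ (½ , SM ⊙ UM) ∷ (½ , (SM ⊙ UM) ⊙ εM) ∷ [])
  ∷ ((- ½ , I₂) ∷ [])
  ∷ []) _

W⁺-relations⇒e1+U-U²S⋆⊗π⁺ : Reduction W⁺-relations (e1+U-U²S ⋆ ⊗ π⁺) []
W⁺-relations⇒e1+U-U²S⋆⊗π⁺ = reduction
  ( ((- ½ , I₂) ∷ (- ½ , (SM ⊙ UM) ⊙ SM) ∷ (- ½ , (SM ⊙ UM) ⊙ εM) ∷ [])
  ∷ ((½ , I₂) ∷ (- ½ , UM) ∷ (½ , UM ⊙ SM) ∷ [])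
  ∷ ((½ , I₂) ∷ [])
  ∷ []) _

W⁺-relations′⇒1+S : Reduction W⁺-relations′ e1+S []
W⁺-relations′⇒1+S = reduction
  ( ((½ , I₂) ∷ (½ , SM) ∷ (½ , SM ⊙ UM) ∷ (- ½ , UM ⊙ UM) ∷ (½ , (SM ⊙ UM) ⊙ SM) ∷ (½ , (SM ⊙ UM) ⊙ εM) ∷ [])
  ∷ ((1ℚ , I₂) ∷ (1ℚ , SM) ∷ [])
  ∷ []) _

W⁺-relations′⇒1+U+U²·1-S : Reduction W⁺-relations′ e1+U+U²·1-S []
W⁺-relations′⇒1+U+U²·1-S = reduction
  ( ((½ , UM) ∷ (- ½ , UM ⊙ SM) ∷ (½ , UM ⊙ UM) ∷ (½ , UM ⊙ εM) ∷ (½ , (SM ⊙ UM) ⊙ UM) ∷ (½ , (SM ⊙ UM) ⊙ εM)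
     ∷ (½ , ((SM ⊙ UM) ⊙ SM) ⊙ UM) ∷ (½ , ((SM ⊙ UM) ⊙ εM) ⊙ UM)
     ∷ (- ½ , (((SM ⊙ UM) ⊙ SM) ⊙ UM) ⊙ SM) ∷ (- ½ , (((SM ⊙ UM) ⊙ εM) ⊙ UM) ⊙ SM) ∷ [])
  ∷ ((1ℚ , I₂) ∷ (-1ℚ , SM) ∷ (1ℚ , UM) ∷ (1ℚ , SM ⊙ UM) ∷ (-1ℚ , UM ⊙ SM) ∷ (-1ℚ , (SM ⊙ UM) ⊙ SM) ∷ [])
  ∷ []) _

kerfA-relations⇒μ : Reduction kerfA-relations μ []
kerfA-relations⇒μ = reduction
  ( ((1ℚ , I₂) ∷ (-1ℚ , UM) ∷ (-1ℚ , SM ⊙ UM) ∷ (-1ℚ , UM ⊙ εM) ∷ (-1ℚ , (SM ⊙ UM) ⊙ εM) ∷ [])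
  ∷ ((1ℚ + 1ℚ , I₂) ∷ [])
  ∷ []) _

μ⇒1-ε : Reduction (μ ∷ []) 1-ε []
μ⇒1-ε = reduction (((½ , I₂) ∷ (- ½ , εM) ∷ []) ∷ []) _

μ⇒e1+U-U²S⊗1+ε : Reduction (1-ε ∷ μ ∷ []) (e1+U-U²S ⊗ 1+ε) []
μ⇒e1+U-U²S⊗1+ε = reduction
  ( ((- ½ , I₂) ∷ (½ , UM) ∷ (½ , SM ⊙ UM) ∷ (½ , UM ⊙ εM) ∷ (½ , (SM ⊙ UM) ⊙ εM) ∷ [])
  ∷ ((½ , I₂) ∷ [])
  ∷ []) _

W⁺-relations′⇒μ⋆ : Reduction W⁺-relations′ (μ ⋆) []
W⁺-relations′⇒μ⋆ = reduction
  ( ((1ℚ , I₂) ∷ (1ℚ , SM ⊙ UM) ∷ (-1ℚ , UM ⊙ UM) ∷ (1ℚ , (SM ⊙ UM) ⊙ SM) ∷ (1ℚ , (SM ⊙ UM) ⊙ εM) ∷ [])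
  ∷ ((ℤ.+ 4 / 1 , I₂) ∷ [])
  ∷ []) _

μ⋆⇒1-ε : Reduction (μ ⋆ ∷ []) 1-ε []
μ⋆⇒1-ε = reduction (((½ , I₂) ∷ (- ½ , εM) ∷ []) ∷ []) _

μ⋆⇒e1+U-U²S⋆⊗π⁺ : Reduction (1-ε ∷ μ ⋆ ∷ []) (e1+U-U²S ⋆ ⊗ π⁺) []
μ⋆⇒e1+U-U²S⋆⊗π⁺ = reduction
  ( ((- ¼ , I₂) ∷ (- ¼ , SM ⊙ UM) ∷ (¼ , UM ⊙ UM) ∷ (- ¼ , (SM ⊙ UM) ⊙ SM) ∷ (- ¼ , (SM ⊙ UM) ⊙ εM) ∷ [])
  ∷ ((¼ , I₂) ∷ [])
  ∷ []) _

-- W⁺, ker f_A and ker f_A^* as annihilators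

module Relations {n} {act : Mat2 → Vec n → Vec n} (A : IsLinearAction act) where
  open GroupRingAction A

  W⁺⇔W⁺-relations : ∀ P → W⁺ act P ⇔ Annihilated W⁺-relations P
  W⁺⇔W⁺-relations P = mk⇔
    (λ { ((P∣1+S , P∣W) , plus) → Equivalence.to (Plus⇔1-ε P) plus ∷ P∣1+S ∷ P∣W ∷ [] })
    (λ { (P∣1-ε ∷ P∣1+S ∷ P∣W ∷ []) → (P∣1+S , P∣W) , Equivalence.from (Plus⇔1-ε P) P∣1-ε })

  W⁺-relations⇔W⁺-relations′ : ∀ P → Annihilated W⁺-relations P ⇔ Annihilated W⁺-relations′ P
  W⁺-relations⇔W⁺-relations′ P = mk⇔
    (λ { ann@(P∣1-ε ∷ _) → P∣1-ε ∷ reduction-sound W⁺-relations⇒e1+U-U²S⋆⊗π⁺ ann ∷ [] })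
    (λ { ann@(P∣1-ε ∷ _) → P∣1-ε ∷ reduction-sound W⁺-relations′⇒1+S ann
                                 ∷ reduction-sound W⁺-relations′⇒1+U+U²·1-S ann ∷ [] })

  kerfA-relations⇔μ : ∀ P → Annihilated kerfA-relations P ⇔ (P ∣ μ ≋ 0v)
  kerfA-relations⇔μ P = mk⇔ (reduction-sound kerfA-relations⇒μ) λ P∣μ →
    let P∣1-ε = reduction-sound μ⇒1-ε (P∣μ ∷ []) in
    P∣1-ε ∷ reduction-sound μ⇒e1+U-U²S⊗1+ε (P∣1-ε ∷ P∣μ ∷ []) ∷ []

  W⁺-relations′⇔μ⋆ : ∀ P → Annihilated W⁺-relations′ P ⇔ (P ∣ μ ⋆ ≋ 0v)
  W⁺-relations′⇔μ⋆ P = mk⇔ (reduction-sound W⁺-relations′⇒μ⋆) λ P∣μ⋆ →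
    let P∣1-ε = reduction-sound μ⋆⇒1-ε (P∣μ⋆ ∷ []) in
    P∣1-ε ∷ reduction-sound μ⋆⇒e1+U-U²S⋆⊗π⁺ (P∣1-ε ∷ P∣μ⋆ ∷ []) ∷ []

  ι-LinearEquiv : LinearEquiv (Annihilated W⁺-relations) (Annihilated kerfA-relations)
  ι-LinearEquiv = record
    { to = _∣ eU·1+ε
    ; from = _∣ ι⁻¹
    ; to-linear = ∣-linear eU·1+ε
    ; from-linear = ∣-linear ι⁻¹
    ; to-∈ = λ P ann → ⊗-reduction eU·1+ε 1-ε ι-plus []
                     ∷ ⊗-reduction eU·1+ε (e1+U-U²S ⊗ 1+ε) ι-kerfA ann ∷ []
    ; from-∈ = λ R ann → ⊗-reduction ι⁻¹ 1-ε ι⁻¹-plus ann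
                       ∷ ⊗-reduction ι⁻¹ e1+S ι⁻¹-1+S ann
                       ∷ ⊗-reduction ι⁻¹ e1+U+U²·1-S ι⁻¹-1+U+U²·1-S ann ∷ []
    ; from∘to = λ P ann → ≋-trans (⊗-reduction eU·1+ε ι⁻¹ ι⊗ι⁻¹≡1 ann) (∣-1ᴳ P)
    ; to∘from = λ R ann → ≋-trans (⊗-reduction ι⁻¹ eU·1+ε ι⁻¹⊗ι≡1 ann) (∣-1ᴳ R) }

module Proposition {n} (ρ : Mat2 → Matrix n) (R : IsRightPGLAction ρ) where
  open Actions ρ R
  module A = GroupRingAction actA-isLinearAction
  module B = GroupRingAction actB-isLinearAction
  module RA = Relations actA-isLinearAction
  module RB = Relations actB-isLinearAction

  KerFA⇔kerfA-relations : ∀ P → KerFA ρ P ⇔ A.Annihilated kerfA-relations P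
  KerFA⇔kerfA-relations P = mk⇔
    (λ { (plus , minus) → Equivalence.to (A.Plus⇔1-ε P) plus
                        ∷ ≋-trans (A.⊗-split e1+U-U²S 1+ε P) (Equivalence.to (A.Minus⇔1+ε _) minus) ∷ [] })
    (λ { (P∣1-ε ∷ P∣x1+ε ∷ []) → Equivalence.from (A.Plus⇔1-ε P) P∣1-ε
                              , Equivalence.from (A.Minus⇔1+ε _)
                                  (≋-trans (≋-sym (A.⊗-split e1+U-U²S 1+ε P)) P∣x1+ε) })

  ⟨∣ᴮe1+U-U²S⋆⊗π⁺,⟩ : ∀ Q P → ⟨ Q ∣ᴮ (e1+U-U²S ⋆ ⊗ π⁺) , P ⟩ ≡ ⟨ Q , P ∣ᴬ π⁺ ∣ᴬ e1+U-U²S ⟩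
  ⟨∣ᴮe1+U-U²S⋆⊗π⁺,⟩ Q P = trans (∣ᴮ-adjoint (e1+U-U²S ⋆ ⊗ π⁺) Q P)
    (⟨⟩-respʳ Q (≋-trans (A.reduction-sound e1+U-U²S⋆⊗π⁺-adjoint {P} []) (A.⊗-split π⁺ e1+U-U²S P)))

  KerFA*⇔W⁺-relations′ : ∀ Q → KerFA* ρ Q ⇔ B.Annihilated W⁺-relations′ Q
  KerFA*⇔W⁺-relations′ Q = mk⇔
    (λ { (plus , orthogonal) → Equivalence.to (B.Plus⇔1-ε Q) plus
        ∷ (λ j → begin
            (Q ∣ᴮ (e1+U-U²S ⋆ ⊗ π⁺)) j               ≡⟨ ⟨,δ⟩ (Q ∣ᴮ (e1+U-U²S ⋆ ⊗ π⁺)) j ⟨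
            ⟨ Q ∣ᴮ (e1+U-U²S ⋆ ⊗ π⁺) , δ j ⟩          ≡⟨ ⟨∣ᴮe1+U-U²S⋆⊗π⁺,⟩ Q (δ j) ⟩
            ⟨ Q , δ j ∣ᴬ π⁺ ∣ᴬ e1+U-U²S ⟩
              ≡⟨ orthogonal (δ j ∣ᴬ π⁺)
                   (Equivalence.from (A.Plus⇔1-ε (δ j ∣ᴬ π⁺)) (A.⊗-reduction π⁺ 1-ε π⁺-plus {δ j} [])) ⟩
            0ℚ                                        ∎)
        ∷ [] })
    (λ { (Q∣1-ε ∷ Q∣x⋆π⁺ ∷ []) → Equivalence.from (B.Plus⇔1-ε Q) Q∣1-ε , λ P plus → begin
        ⟨ Q , P ∣ᴬ e1+U-U²S ⟩                 ≡⟨ ⟨⟩-respʳ Q (A.reduction-sound e1+U-U²S-plus-part {P}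
                                                                 (Equivalence.to (A.Plus⇔1-ε P) plus ∷ [])) ⟩
        ⟨ Q , P ∣ᴬ (π⁺ ⊗ e1+U-U²S) ⟩          ≡⟨ ⟨⟩-respʳ Q (A.⊗-split π⁺ e1+U-U²S P) ⟩
        ⟨ Q , P ∣ᴬ π⁺ ∣ᴬ e1+U-U²S ⟩           ≡⟨ ⟨∣ᴮe1+U-U²S⋆⊗π⁺,⟩ Q P ⟨
        ⟨ Q ∣ᴮ (e1+U-U²S ⋆ ⊗ π⁺) , P ⟩        ≡⟨ trans (⟨⟩-respˡ P Q∣x⋆π⁺) (⟨0v,⟩ P) ⟩
        0ℚ                                     ∎ })
    where open ≡-Reasoning

  KerFA*⇔W⁺ : ∀ Q → KerFA* ρ Q ⇔ W⁺ (actB ρ) Q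
  KerFA*⇔W⁺ Q = ⇔.trans (KerFA*⇔W⁺-relations′ Q)
                 (⇔.sym (⇔.trans (RB.W⁺⇔W⁺-relations Q) (RB.W⁺-relations⇔W⁺-relations′ Q)))

  ι-LinearEquiv : LinearEquiv (W⁺ (actA ρ)) (KerFA ρ)
  ι-LinearEquiv = LinearEquiv-resp-⇔ RA.W⁺⇔W⁺-relations KerFA⇔kerfA-relations RA.ι-LinearEquiv

  K : Mat n n
  K = matrix (_∣ᴬ μ)

  KerFA⇔LeftKernel : ∀ P → KerFA ρ P ⇔ LeftKernel K P
  KerFA⇔LeftKernel P = ⇔.trans (KerFA⇔kerfA-relations P) (⇔.trans (RA.kerfA-relations⇔μ P)
    (mk⇔ (≋-trans (≋-sym (linear⇒*ᴹ-matrix (A.∣-linear μ) P)))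
         (≋-trans (linear⇒*ᴹ-matrix (A.∣-linear μ) P))))

  W⁺⇔RightKernel : ∀ Q → W⁺ (actB ρ) Q ⇔ RightKernel K Q
  W⁺⇔RightKernel Q = ⇔.trans (RB.W⁺⇔W⁺-relations Q) (⇔.trans (RB.W⁺-relations⇔W⁺-relations′ Q)
    (⇔.trans (RB.W⁺-relations′⇔μ⋆ Q) (mk⇔ (≋-trans (≋-sym (∣ᴮ⋆≋matrix μ Q))) (≋-trans (∣ᴮ⋆≋matrix μ Q)))))

  equal-dimensions : Σ ℕ λ k → HasDim (W⁺ (actA ρ)) k × HasDim (W⁺ (actB ρ)) k
  equal-dimensions with square-nullities n K
  ... | k , left , right =
    k , HasDim-transport ι-LinearEquiv (HasDim-resp-⇔ KerFA⇔LeftKernel left) ,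
        HasDim-resp-⇔ W⁺⇔RightKernel right

proposition2p2 : (n : ℕ) (ρ : Mat2 → Matrix n) → IsRightPGLAction ρ →
    ((∀ Q → KerFA* ρ Q ⇔ W⁺ (actB ρ) Q) ×
     (∀ P → W⁺ (actA ρ) P → KerFA ρ (ι ρ P)) ×
     (∀ P P′ → W⁺ (actA ρ) P → W⁺ (actA ρ) P′ → ι ρ P ≋ ι ρ P′ → P ≋ P′) ×
     (∀ R → KerFA ρ R → ∃ λ P → W⁺ (actA ρ) P × (ι ρ P ≋ R)) ×
     (Σ ℕ λ k → HasDim (W⁺ (actA ρ)) k × HasDim (W⁺ (actB ρ)) k))
proposition2p2 n ρ R = KerFA*⇔W⁺ , to-∈ , (λ _ _ → to-injective) , to-surjective , equal-dimensions
  where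
  open Proposition ρ R
  open LinearEquiv ι-LinearEquiv
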